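{- Let $(E,\mathcal F,\mathcal L)$ be an oriented interval greedoid and $W\subseteq E$. If $\mathrm{res}_W(\alpha)=\alpha|_W$ for all $\alpha\in\mathcal L$, then $(W,\mathcal F|_W,\mathcal L|_W)$ is an oriented interval greedoid, where $\mathcal L|_W=\{\mathrm{res}_W(\alpha):\alpha\in\mathcal L\}$.
   Context: Interval greedoid: finite $E$, nonempty family $\mathcal F$ with (IG1) each nonempty $X\in\mathcal F$ has $x$ with $X\setminus\{x\}\in\mathcal F$; (IG2) if $|X|>|Y|$ there is $x\in X\setminus Y$ with $Y\cup\{x\}\in\mathcal F$; (IG3) if $X\subseteq Y\subseteq Z$ in $\mathcal F$, $e\notin Z$, $X\cup\{e\},Z\cup\{e\}\in\mathcal F$, then $Y\cup\{e\}\in\mathcal F$. $\Gamma(X)=\{x\in E\setminus X:X\cup\{x\}\in\mathcal F\}$; $X\sim Y$ iff $\Gamma(X)=\Gamma(Y)$; classes $[X]$ are flats; $\Phi$ the set of flats ordered by $[X]\le[Y]$ iff there is $Z\subseteq E\setminus Y$ with $Y\cup Z\in\mathcal F$ and $Y\cup Z\sim X$ (a lattice). For a flat $A=[X]$: $\Gamma(A)=\Gamma(X)$, $\xi(A)=\bigcup_{X'\sim X}X'$; $\mu(S)=[X]$ for $X$ inclusion-maximal feasible in $S$; join $A\vee B=\mu(\xi(A)\cap\xi(B))$. A covector is $\alpha:E\to\{0,+,-,1\}$ such that for some flat $A=\mathrm{supp}(\alpha)$, $\alpha\in\{+,-\}$ on $\Gamma(A)$, $0$ on $\xi(A)$, $1$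 elsewhere. Symbols ordered $0<+<1$, $0<-<1$. Product: with $C=\mathrm{supp}\,\alpha\vee\mathrm{supp}\,\beta$, $(\alpha\circ\beta)(e)=\beta(e)$ if $e\in\Gamma(C)\cup\xi(C)$ and $\beta(e)>\alpha(e)$; $\alpha(e)$ if $e\in\Gamma(C)\cup\xi(C)$ otherwise; $1$ otherwise. $-\alpha$ swaps $+,-$; $S(\alpha,\beta)=\{e:\alpha(e)=-\beta(e)\in\{+,-\}\}$. Oriented interval greedoid: $(E,\mathcal F,\mathcal L)$, $\mathcal L$ a set of covectors with (OG1) $\mathrm{supp}:\mathcal L\to\Phi$ surjective; (OG2) $-\mathcal L=\mathcal L$; (OG3) closed under $\circ$; (OG4) if $\alpha,\beta\in\mathcal L$, $x\in S(\alpha,\beta)$, $(\alpha\circ\beta)(x)\ne1$, some $\gamma\in\mathcal L$ has $\gamma(x)=0$ and $\gamma(y)=(\alpha\circ\beta)(y)=(\beta\circ\alpha)(y)$ for all $y\notin S(\alpha,\beta)$ with $(\alpha\circ\beta)(y)\neq1$. Restriction: for $W\subseteq E$, $\mathcal F|_W=\{X\in\mathcal F:X\subseteq W\}$; $(W,\mathcal F|_W)$ is an interval greedoid with its own $\Gamma|_W,\xi|_W,\mu|_W,\Phi|_W$. For $C\in\Phi$ put $C|_W=\mu|_W(W\cap\xi(C))\in\Phi|_W$. For a covector $\alpha$ with $A=\mathrm{supp}(\alpha)$ (one has $\Gamma|_W(A|_W)\subseteq\Gamma(A)$), $\mathrm{res}_W(\alpha):W\to\{0,+,-,1\}$ is $0$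 on $\xi|_W(A|_W)$, equals $\alpha$ on $\Gamma|_W(A|_W)$, and is $1$ elsewhere on $W$. -}

module Defs where

open import Data.Nat using (ℕ; _<_)
open import Data.Bool using (Bool; T; _∧_)
open import Data.Fin using (Fin)
open import Data.Fin.Subset using (Subset; _∈_; _∉_; _⊆_; _∪_; ⁅_⁆; _-_; ∣_∣; Nonempty)
open import Data.Fin.Subset.Properties using (_⊆?_)
open import Data.Vec using (Vec; lookup; map)
open import Data.Product using (Σ; ∃; _×_; _,_)
open import Data.Sum using (_⊎_)
open import Relation.Nullary using (¬_)
open import Relation.Nullary.Decidable using (⌊_⌋)
open import Relation.Binary.PropositionalEquality using (_≡_; _≢_)

data Sym : Set where
  𝟎 ⊕ ⊖ 𝟏 : Sym

infix 4 _<ˢ_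
infix 30 _⟨_⟩
data _<ˢ_ : Sym → Sym → Set where
  0<+ : 𝟎 <ˢ ⊕
  0<- : 𝟎 <ˢ ⊖
  0<1 : 𝟎 <ˢ 𝟏
  +<1 : ⊕ <ˢ 𝟏
  -<1 : ⊖ <ˢ 𝟏

neg : Sym → Sym
neg 𝟎 = 𝟎
neg ⊕ = ⊖
neg ⊖ = ⊕
neg 𝟏 = 𝟏

-- A covector on a ground
-- set G ⊆ Fin n is represented by a vector that is 𝟏 outside G
-- (this is forced by the covector definition below: "1 elsewhere").
SignVec : ℕ → Set
SignVec n = Vec Sym n

_⟨_⟩ : ∀ {n} → SignVec n → Fin n → Sym
α ⟨ e ⟩ = lookup α e

Sep : ∀ {n} → SignVec n → SignVec n → Fin n → Set
Sep α β e = (α ⟨ e ⟩ ≡ ⊕ × β ⟨ e ⟩ ≡ ⊖) ⊎ (α ⟨ e ⟩ ≡ ⊖ × β ⟨ e ⟩ ≡ ⊕)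

_⊆ᴾ_ : ∀ {n} → Subset n → (Fin n → Set) → Set
X ⊆ᴾ S = ∀ e → e ∈ X → S e

module _ {n : ℕ} (G : Subset n) (𝓕 : Subset n → Bool) where

  Feas : Subset n → Set
  Feas X = T (𝓕 X)

  record IsIntervalGreedoid : Set where
    field
      ground   : ∀ X → Feas X → X ⊆ G
      nonempty : ∃ λ X → Feas X
      IG1 : ∀ X → Feas X → Nonempty X → ∃ λ x → x ∈ X × Feas (X - x)
      IG2 : ∀ X Y → Feas X → Feas Y → ∣ Y ∣ < ∣ X ∣ →
            ∃ λ x → x ∈ X × x ∉ Y × Feas (Y ∪ ⁅ x ⁆)
      IG3 : ∀ X Y Z e → Feas X → Feas Y → Feas Z → X ⊆ Y → Y ⊆ Z →
            e ∉ Z → Feas (X ∪ ⁅ e ⁆) → Feas (Z ∪ ⁅ e ⁆) → Feas (Y ∪ ⁅ e ⁆)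

  Γ : Subset n → Fin n → Set
  Γ X e = e ∈ G × e ∉ X × Feas (X ∪ ⁅ e ⁆)

  _∼_ : Subset n → Subset n → Set
  X ∼ Y = (∀ e → Γ X e → Γ Y e) × (∀ e → Γ Y e → Γ X e)

  -- Flats are represented by feasible representatives; the flat [X].
  -- ξ([X]) = union of all feasible X' ∼ X
  ξ : Subset n → Fin n → Set
  ξ X e = ∃ λ X' → Feas X' × X' ∼ X × e ∈ X'

  IsMu : (Fin n → Set) → Subset n → Set
  IsMu S X = Feas X × X ⊆ᴾ S ×
             (∀ Y → Feas Y → X ⊆ Y → Y ⊆ᴾ S → Y ⊆ X)

  IsJoin : Subset n → Subset n → Subset n → Set
  IsJoin A B C = IsMu (λ e → ξ A e × ξ B e) C

  IsCovectorOn : Subset n → SignVec n → Set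
  IsCovectorOn A α = Feas A × (∀ e →
      (Γ A e → α ⟨ e ⟩ ≡ ⊕ ⊎ α ⟨ e ⟩ ≡ ⊖) ×
      (ξ A e → α ⟨ e ⟩ ≡ 𝟎) ×
      (¬ Γ A e → ¬ ξ A e → α ⟨ e ⟩ ≡ 𝟏))

  IsCovector : SignVec n → Set
  IsCovector α = ∃ λ A → IsCovectorOn A α

  IsProduct : SignVec n → SignVec n → SignVec n → Set
  IsProduct α β γ = ∃ λ A → ∃ λ B → ∃ λ C →
      IsCovectorOn A α × IsCovectorOn B β × IsJoin A B C × (∀ e →
        ((Γ C e ⊎ ξ C e) → α ⟨ e ⟩ <ˢ β ⟨ e ⟩ → γ ⟨ e ⟩ ≡ β ⟨ e ⟩) ×
        ((Γ C e ⊎ ξ C e) → ¬ (α ⟨ e ⟩ <ˢ β ⟨ e ⟩) → γ ⟨ e ⟩ ≡ α ⟨ e ⟩) ×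
        (¬ (Γ C e ⊎ ξ C e) → γ ⟨ e ⟩ ≡ 𝟏))

  record IsOrientedIntervalGreedoid (𝓛 : SignVec n → Set) : Set where
    field
      greedoid  : IsIntervalGreedoid
      covectors : ∀ α → 𝓛 α → IsCovector α
      OG1 : ∀ A → Feas A → ∃ λ α → 𝓛 α × IsCovectorOn A α
      OG2 : ∀ α → 𝓛 α → 𝓛 (map neg α)
      OG3 : ∀ α β γ → 𝓛 α → 𝓛 β → IsProduct α β γ → 𝓛 γ
      OG4 : ∀ α β αβ βα → 𝓛 α → 𝓛 β → IsProduct α β αβ → IsProduct β α βα →
            ∀ x → Sep α β x → αβ ⟨ x ⟩ ≢ 𝟏 →
            ∃ λ γ → 𝓛 γ × γ ⟨ x ⟩ ≡ 𝟎 ×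
              (∀ y → ¬ Sep α β y → αβ ⟨ y ⟩ ≢ 𝟏 →
                 γ ⟨ y ⟩ ≡ αβ ⟨ y ⟩ × γ ⟨ y ⟩ ≡ βα ⟨ y ⟩)

restrictF : ∀ {n} → (Subset n → Bool) → Subset n → Subset n → Bool
restrictF 𝓕 W X = 𝓕 X ∧ ⌊ X ⊆? W ⌋

IsRes : ∀ {n} (G : Subset n) (𝓕 : Subset n → Bool) (W : Subset n) →
        SignVec n → SignVec n → Set
IsRes G 𝓕 W α γ = ∃ λ A → IsCovectorOn G 𝓕 A α × ∃ λ AW →
    IsMu W (restrictF 𝓕 W) (λ e → e ∈ W × ξ G 𝓕 A e) AW × (∀ e →
      (ξ W (restrictF 𝓕 W) AW e → γ ⟨ e ⟩ ≡ 𝟎) ×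
      (Γ W (restrictF 𝓕 W) AW e → γ ⟨ e ⟩ ≡ α ⟨ e ⟩) ×
      (¬ ξ W (restrictF 𝓕 W) AW e → ¬ Γ W (restrictF 𝓕 W) AW e → γ ⟨ e ⟩ ≡ 𝟏))

restrictL : ∀ {n} (G : Subset n) (𝓕 : Subset n → Bool) (𝓛 : SignVec n → Set)
            (W : Subset n) → SignVec n → Set
restrictL G 𝓕 𝓛 W γ = ∃ λ α → 𝓛 α × IsRes G 𝓕 W α γ

-- A covector α on a flat A restricts along A|_W = μ|_W(W ∩ ξ(A)). Every Γ-extension of A|_W
-- in W is one of A, so res_W(α) is a covector of the restriction, and OG1, OG2 are inherited
-- directly. For OG3 and OG4 the point is that a product γ₁ ∘ γ₂ of restrictions is the
-- restriction of α₁ ∘ α₂: the hypothesis res_W(α) = α|_W identifies ξ|_W of the support of γᵢ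
-- with W ∩ ξ of the support of αᵢ, and a rank argument with IG2 shows that the join computed
-- in W is equivalent to the restriction of the join computed in E. OG3 and OG4 for the
-- restriction then follow from OG3 and OG4 for 𝓛, the eliminating covector of OG4 being
-- restricted to W.
module Submission where

open import Defs
open import Data.Nat using (ℕ; _≤_)
open import Data.Nat.Properties using (≮⇒≥; ≤-<-trans)
open import Data.Bool using (Bool; T)
open import Data.Bool.Properties using (T-∧)
open import Data.Fin using (Fin)
open import Data.Fin.Subset using (Subset; _∈_; _∉_; _⊆_; _⊂_; _⊃_; _∪_; ⁅_⁆; _-_; ∣_∣; ⊥; ⊤)
open import Data.Fin.Subset.Properties
  using (_∈?_; _⊆?_; _⊂?_; ∉⊥; ⊥⊆; x∈⁅x⁆; x∈⁅y⁆⇒x≡y; p⊆p∪q; q⊆p∪q; x∈p∪q⁻; p─q⊆p;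
         p⊂q⇒∣p∣<∣q∣; x∈p⇒p-x⊂p; Empty-unique; anySubset?; nonempty?)
open import Data.Fin.Subset.Induction using (Acc; acc; ⊂-wellFounded; ⊃-wellFounded)
open import Data.Fin.Properties using (all?)
open import Data.Vec using (map; tabulate)
open import Data.Vec.Properties using (lookup∘tabulate; lookup-map)
open import Data.Product using (∃; _×_; _,_; proj₁; proj₂)
open import Data.Sum using (_⊎_; inj₁; inj₂; [_,_])
import Data.Sum as Sum
open import Data.Empty using (⊥-elim)
open import Function using (_∘_; id)
open import Function.Bundles using (Equivalence)
open import Relation.Nullary using (¬_; Dec; yes; no)
open import Relation.Nullary.Decidable using (T?; toWitness; fromWitness; _×-dec_; _⊎-dec_; _→-dec_; ¬?)
open import Relation.Binary.PropositionalEquality using (_≡_; _≢_; refl; sym; trans; subst; cong; cong₂)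
open Relation.Binary.PropositionalEquality.≡-Reasoning

module _ {n : ℕ} where

  x∈p∪⁅y⁆⁻ : ∀ {x y : Fin n} (p : Subset n) → x ∈ p ∪ ⁅ y ⁆ → x ∈ p ⊎ x ≡ y
  x∈p∪⁅y⁆⁻ {y = y} p x∈ = Sum.map₂ (x∈⁅y⁆⇒x≡y y) (x∈p∪q⁻ p ⁅ y ⁆ x∈)

  x∈p∪⁅x⁆ : ∀ (x : Fin n) p → x ∈ p ∪ ⁅ x ⁆
  x∈p∪⁅x⁆ x p = q⊆p∪q p ⁅ x ⁆ (x∈⁅x⁆ x)

  x∉p⇒p⊂p∪⁅x⁆ : ∀ {x : Fin n} {p} → x ∉ p → p ⊂ p ∪ ⁅ x ⁆
  x∉p⇒p⊂p∪⁅x⁆ {x} {p} x∉p = p⊆p∪q ⁅ x ⁆ , x , x∈p∪⁅x⁆ x p , x∉p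

  p∪⁅x⁆⊆ᴾ : ∀ {S : Fin n → Set} {p x} → p ⊆ᴾ S → S x → (p ∪ ⁅ x ⁆) ⊆ᴾ S
  p∪⁅x⁆⊆ᴾ {p = p} p⊆S Sx e e∈ with x∈p∪⁅y⁆⁻ p e∈
  ... | inj₁ e∈p = p⊆S e e∈p
  ... | inj₂ refl = Sx

  ⊆ᴾ? : ∀ {S : Fin n → Set} → (∀ e → Dec (S e)) → ∀ p → Dec (p ⊆ᴾ S)
  ⊆ᴾ? S? p = all? λ e → e ∈? p →-dec S? e

  ⊆-maximal : (P : Subset n → Set) → (∀ p → Dec (P p)) → ∀ {p} → P p →
              ∃ λ m → P m × (∀ q → P q → m ⊆ q → q ⊆ m)
  ⊆-maximal P P? Pp = climb _ (⊃-wellFounded _) Pp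
    where
    climb : ∀ p → Acc _⊃_ p → P p → ∃ λ m → P m × (∀ q → P q → m ⊆ q → q ⊆ m)
    climb p (acc larger) Pp with anySubset? (λ q → P? q ×-dec p ⊂? q)
    ... | yes (q , Pq , p⊂q) = climb q (larger p⊂q) Pq
    ... | no  ¬larger = p , Pp , maximal
      where
      maximal : ∀ q → P q → p ⊆ q → q ⊆ p
      maximal q Pq p⊆q {x} x∈q with x ∈? p
      ... | yes x∈p = x∈p
      ... | no  x∉p = ⊥-elim (¬larger (q , Pq , p⊆q , x , x∈q , x∉p))

_<ˢ?_ : ∀ a b → Dec (a <ˢ b)
𝟎 <ˢ? 𝟎 = no λ ()
𝟎 <ˢ? ⊕ = yes 0<+
𝟎 <ˢ? ⊖ = yes 0<-
𝟎 <ˢ? 𝟏 = yes 0<1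
⊕ <ˢ? 𝟏 = yes +<1
⊖ <ˢ? 𝟏 = yes -<1
⊕ <ˢ? 𝟎 = no λ ()
⊕ <ˢ? ⊕ = no λ ()
⊕ <ˢ? ⊖ = no λ ()
⊖ <ˢ? 𝟎 = no λ ()
⊖ <ˢ? ⊕ = no λ ()
⊖ <ˢ? ⊖ = no λ ()
𝟏 <ˢ? _ = no λ ()

≮𝟎 : ∀ {a} → ¬ a <ˢ 𝟎
≮𝟎 ()

𝟎≮⇒≡𝟎 : ∀ {b} → ¬ 𝟎 <ˢ b → b ≡ 𝟎
𝟎≮⇒≡𝟎 {𝟎} _    = refl
𝟎≮⇒≡𝟎 {⊕} 𝟎≮b = ⊥-elim (𝟎≮b 0<+)
𝟎≮⇒≡𝟎 {⊖} 𝟎≮b = ⊥-elim (𝟎≮b 0<-)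
𝟎≮⇒≡𝟎 {𝟏} 𝟎≮b = ⊥-elim (𝟎≮b 0<1)

IsSign : Sym → Set
IsSign s = s ≡ ⊕ ⊎ s ≡ ⊖

sign≢𝟎 : ∀ {s} → IsSign s → s ≢ 𝟎
sign≢𝟎 (inj₁ refl) ()
sign≢𝟎 (inj₂ refl) ()

sign≢𝟏 : ∀ {s} → IsSign s → s ≢ 𝟏
sign≢𝟏 (inj₁ refl) ()
sign≢𝟏 (inj₂ refl) ()

𝟏≢𝟎 : 𝟏 ≢ 𝟎
𝟏≢𝟎 ()

infixl 7 _∘ˢ_
_∘ˢ_ : Sym → Sym → Sym
a ∘ˢ b with a <ˢ? b
... | yes _ = b
... | no  _ = a

∘ˢ-< : ∀ {a b} → a <ˢ b → a ∘ˢ b ≡ b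
∘ˢ-< {a} {b} a<b with a <ˢ? b
... | yes _   = refl
... | no  a≮b = ⊥-elim (a≮b a<b)

∘ˢ-≮ : ∀ {a b} → ¬ a <ˢ b → a ∘ˢ b ≡ a
∘ˢ-≮ {a} {b} a≮b with a <ˢ? b
... | yes a<b = ⊥-elim (a≮b a<b)
... | no  _   = refl

∘ˢ-cases : ∀ {a b c} → (a <ˢ b → c ≡ b) → (¬ a <ˢ b → c ≡ a) → c ≡ a ∘ˢ b
∘ˢ-cases {a} {b} if< if≮ with a <ˢ? b
... | yes a<b = if< a<b
... | no  a≮b = if≮ a≮b

∘ˢ-≡𝟎⁻ : ∀ a b → a ∘ˢ b ≡ 𝟎 → a ≡ 𝟎 × b ≡ 𝟎
∘ˢ-≡𝟎⁻ a b eq with a <ˢ? b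
... | yes a<b = ⊥-elim (≮𝟎 (subst (a <ˢ_) eq a<b))
... | no  a≮b = eq , 𝟎≮⇒≡𝟎 (subst (λ x → ¬ x <ˢ b) eq a≮b)

module _ {P Q : Set} where

  covectorSign : Dec P → Dec Q → Sym → Sym
  covectorSign (yes _) _       s = 𝟎
  covectorSign (no _)  (yes _) s = s
  covectorSign (no _)  (no _)  s = 𝟏

  covectorSign-P : ∀ (p? : Dec P) (q? : Dec Q) {s} → P → covectorSign p? q? s ≡ 𝟎
  covectorSign-P (yes _) _ _ = refl
  covectorSign-P (no ¬p) _ p = ⊥-elim (¬p p)

  covectorSign-Q : ∀ (p? : Dec P) (q? : Dec Q) {s} → (P → ¬ Q) → Q → covectorSign p? q? s ≡ s
  covectorSign-Q (yes p) _       P∩Q q = ⊥-elim (P∩Q p q)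
  covectorSign-Q (no _)  (yes _) _   _ = refl
  covectorSign-Q (no _)  (no ¬q) _   q = ⊥-elim (¬q q)

  covectorSign-else : ∀ (p? : Dec P) (q? : Dec Q) {s} → ¬ P → ¬ Q → covectorSign p? q? s ≡ 𝟏
  covectorSign-else (yes p) _       ¬p _  = ⊥-elim (¬p p)
  covectorSign-else (no _)  (yes q) _  ¬q = ⊥-elim (¬q q)
  covectorSign-else (no _)  (no _)  _  _  = refl

keepOr𝟏 : {P : Set} → Dec P → Sym → Sym
keepOr𝟏 (yes _) s = s
keepOr𝟏 (no _)  s = 𝟏

keepOr𝟏-yes : ∀ {P : Set} (p? : Dec P) {s} → P → keepOr𝟏 p? s ≡ s
keepOr𝟏-yes (yes _) _ = refl
keepOr𝟏-yes (no ¬p) p = ⊥-elim (¬p p)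

keepOr𝟏-no : ∀ {P : Set} (p? : Dec P) {s} → ¬ P → keepOr𝟏 p? s ≡ 𝟏
keepOr𝟏-no (yes p) ¬p = ⊥-elim (¬p p)
keepOr𝟏-no (no _)  _  = refl

module _ {n : ℕ} {e : Fin n} where

  neg-≡ : ∀ α {s} → α ⟨ e ⟩ ≡ s → map neg α ⟨ e ⟩ ≡ neg s
  neg-≡ α αₑ≡s = trans (lookup-map e neg α) (cong neg αₑ≡s)

  neg-cong : ∀ α β → α ⟨ e ⟩ ≡ β ⟨ e ⟩ → map neg α ⟨ e ⟩ ≡ map neg β ⟨ e ⟩
  neg-cong α β αₑ≡βₑ = trans (neg-≡ α αₑ≡βₑ) (sym (lookup-map e neg β))

  neg-IsSign : ∀ α → IsSign (α ⟨ e ⟩) → IsSign (map neg α ⟨ e ⟩)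
  neg-IsSign α (inj₁ αₑ≡⊕) = inj₂ (neg-≡ α αₑ≡⊕)
  neg-IsSign α (inj₂ αₑ≡⊖) = inj₁ (neg-≡ α αₑ≡⊖)

Sep-cong : ∀ {n} (α β α′ β′ : SignVec n) {e} → α ⟨ e ⟩ ≡ α′ ⟨ e ⟩ → β ⟨ e ⟩ ≡ β′ ⟨ e ⟩ → Sep α β e → Sep α′ β′ e
Sep-cong _ _ _ _ α≡ β≡ (inj₁ (αₑ , βₑ)) = inj₁ (trans (sym α≡) αₑ , trans (sym β≡) βₑ)
Sep-cong _ _ _ _ α≡ β≡ (inj₂ (αₑ , βₑ)) = inj₂ (trans (sym α≡) αₑ , trans (sym β≡) βₑ)

Sep⇒≢𝟏 : ∀ {n} (α β : SignVec n) e → Sep α β e → α ⟨ e ⟩ ≢ 𝟏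
Sep⇒≢𝟏 _ _ _ (inj₁ (αₑ , _)) = sign≢𝟏 (inj₁ αₑ)
Sep⇒≢𝟏 _ _ _ (inj₂ (αₑ , _)) = sign≢𝟏 (inj₂ αₑ)

module Greedoid {n : ℕ} (G : Subset n) (𝓕 : Subset n → Bool) (ig : IsIntervalGreedoid G 𝓕) where
  open IsIntervalGreedoid ig public

  Feasible : Subset n → Set
  Feasible = Feas G 𝓕

  Γ′ : Subset n → Fin n → Set
  Γ′ = Γ G 𝓕

  ξ′ : Subset n → Fin n → Set
  ξ′ = ξ G 𝓕

  _≈_ : Subset n → Subset n → Set
  _≈_ = _∼_ G 𝓕

  private
    variable
      A B C C″ X Y Z : Subset n
      e x : Fin n
      α β : SignVec n
      S : Fin n → Set

  Feasible? : ∀ X → Dec (Feasible X)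
  Feasible? X = T? (𝓕 X)

  Γ? : ∀ X e → Dec (Γ′ X e)
  Γ? X e = e ∈? G ×-dec ¬? (e ∈? X) ×-dec Feasible? (X ∪ ⁅ e ⁆)

  ≈? : ∀ X Y → Dec (X ≈ Y)
  ≈? X Y = all? (λ e → Γ? X e →-dec Γ? Y e) ×-dec all? (λ e → Γ? Y e →-dec Γ? X e)

  ξ? : ∀ X e → Dec (ξ′ X e)
  ξ? X e = anySubset? λ X′ → Feasible? X′ ×-dec ≈? X′ X ×-dec e ∈? X′

  ≈-refl : X ≈ X
  ≈-refl = (λ _ → id) , (λ _ → id)

  ≈-sym : X ≈ Y → Y ≈ X
  ≈-sym (ΓX⊆ΓY , ΓY⊆ΓX) = ΓY⊆ΓX , ΓX⊆ΓY

  ≈-trans : X ≈ Y → Y ≈ Z → X ≈ Z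
  ≈-trans (ΓX⊆ΓY , ΓY⊆ΓX) (ΓY⊆ΓZ , ΓZ⊆ΓY) = (λ e → ΓY⊆ΓZ e ∘ ΓX⊆ΓY e) , (λ e → ΓY⊆ΓX e ∘ ΓZ⊆ΓY e)

  ξ-resp-≈ : X ≈ Y → ξ′ X e → ξ′ Y e
  ξ-resp-≈ X≈Y (X′ , fX′ , X′≈X , e∈X′) = X′ , fX′ , ≈-trans X′≈X X≈Y , e∈X′

  ⊆ξ : Feasible X → X ⊆ᴾ ξ′ X
  ⊆ξ fX e e∈X = _ , fX , ≈-refl , e∈X

  Γ-∉ : Γ′ X e → e ∉ X
  Γ-∉ (_ , e∉X , _) = e∉X

  Γ-intro : Feasible (X ∪ ⁅ x ⁆) → x ∉ X → Γ′ X x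
  Γ-intro {X} {x} fXx x∉X = ground _ fXx (x∈p∪⁅x⁆ x X) , x∉X , fXx

  ξ⇒¬Γ : ξ′ X e → ¬ Γ′ X e
  ξ⇒¬Γ (X′ , _ , (_ , ΓX⊆ΓX′) , e∈X′) g = Γ-∉ (ΓX⊆ΓX′ _ g) e∈X′

  ⊥-feasible : Feasible ⊥
  ⊥-feasible = descend _ (⊂-wellFounded _) (proj₂ nonempty)
    where
    descend : ∀ X → Acc _⊂_ X → Feasible X → Feasible ⊥
    descend X (acc smaller) fX with nonempty? X
    ... | no  empty = subst Feasible (Empty-unique empty) fX
    ... | yes ne    = let x , x∈X , fX-x = IG1 X fX ne in descend (X - x) (smaller (x∈p⇒p-x⊂p x∈X)) fX-x

  IsMu-exists : (S : Fin n → Set) → (∀ e → Dec (S e)) → ∃ (IsMu G 𝓕 S)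
  IsMu-exists S S? =
    let M , (fM , M⊆S) , maximal = ⊆-maximal (λ X → Feasible X × X ⊆ᴾ S)
                                     (λ X → Feasible? X ×-dec ⊆ᴾ? S? X) (⊥-feasible , λ _ → ⊥-elim ∘ ∉⊥)
    in M , fM , M⊆S , λ Y fY M⊆Y Y⊆S → maximal Y (fY , Y⊆S) M⊆Y

  join-exists : ∀ A B → ∃ (IsJoin G 𝓕 A B)
  join-exists A B = IsMu-exists _ λ e → ξ? A e ×-dec ξ? B e

  IsMu-Γ-disjoint : IsMu G 𝓕 S C → S x → ¬ Γ′ C x
  IsMu-Γ-disjoint {C = C} {x = x} (_ , C⊆S , maximal) Sx (_ , x∉C , fCx) =
    x∉C (maximal (C ∪ ⁅ x ⁆) fCx (p⊆p∪q ⁅ x ⁆) (p∪⁅x⁆⊆ᴾ C⊆S Sx) (x∈p∪⁅x⁆ x C))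

  IsMu-rank-maximum : IsMu G 𝓕 S C → Feasible Y → Y ⊆ᴾ S → ∣ Y ∣ ≤ ∣ C ∣
  IsMu-rank-maximum {C = C} {Y = Y} μC@(fC , _) fY Y⊆S = ≮⇒≥ λ C<Y →
    let y , y∈Y , y∉C , fCy = IG2 Y C fY fC C<Y
    in IsMu-Γ-disjoint μC (Y⊆S y y∈Y) (Γ-intro fCy y∉C)

  Γ-transfer : Feasible A → Feasible Y → ∣ A ∣ ≤ ∣ Y ∣ → Y ⊆ᴾ (λ y → ¬ Γ′ A y) → Γ′ Y x → Γ′ A x
  Γ-transfer {A} {Y} {x} fA fY A≤Y Y-avoids (_ , x∉Y , fYx)
    with IG2 (Y ∪ ⁅ x ⁆) A fYx fA (≤-<-trans A≤Y (p⊂q⇒∣p∣<∣q∣ (x∉p⇒p⊂p∪⁅x⁆ x∉Y)))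
  ... | w , w∈Yx , w∉A , fAw with x∈p∪⁅y⁆⁻ Y w∈Yx
  ...   | inj₁ w∈Y = ⊥-elim (Y-avoids w w∈Y (Γ-intro fAw w∉A))
  ...   | inj₂ refl = Γ-intro fAw w∉A

  avoidsΓ⇒≈ : Feasible A → Feasible Y → Y ⊆ᴾ (λ y → ¬ Γ′ A y) → ∣ A ∣ ≤ ∣ Y ∣ → Y ≈ A
  avoidsΓ⇒≈ {A} {Y} fA fY Y-avoids A≤Y = ΓY⊆ΓA , ΓA⊆ΓY
    where
    Y≤A : ∣ Y ∣ ≤ ∣ A ∣
    Y≤A = ≮⇒≥ λ A<Y → let y , y∈Y , y∉A , fAy = IG2 Y A fY fA A<Y in Y-avoids y y∈Y (Γ-intro fAy y∉A)
    ΓY⊆ΓA : ∀ x → Γ′ Y x → Γ′ A x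
    ΓY⊆ΓA _ = Γ-transfer fA fY A≤Y Y-avoids
    ΓA⊆ΓY : ∀ x → Γ′ A x → Γ′ Y x
    ΓA⊆ΓY _ = Γ-transfer fY fA Y≤A λ w w∈A g → Γ-∉ (ΓY⊆ΓA w g) w∈A

  -- Grow X ∪ {e} inside the complement of Γ(A) up to the rank of A; the result is then
  -- equivalent to A, which would put e into ξ(A).
  ξ-extension⇒Γ : Feasible A → X ⊆ᴾ ξ′ A → ¬ ξ′ A e → Feasible (X ∪ ⁅ e ⁆) → Γ′ A e
  ξ-extension⇒Γ {A} {X} {e} fA X⊆ξA e∉ξA fXe with Γ? A e
  ... | yes e∈ΓA = e∈ΓA
  ... | no  e∉ΓA =
    let M , (fM , e∈M , M-avoids) , maximal = ⊆-maximal P P? start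
        A≤M = ≮⇒≥ λ M<A →
          let x , x∈A , x∉M , fMx = IG2 A M fA fM M<A
              Mx-avoids = p∪⁅x⁆⊆ᴾ M-avoids λ g → Γ-∉ g x∈A
          in x∉M (maximal _ (fMx , p⊆p∪q ⁅ x ⁆ e∈M , Mx-avoids) (p⊆p∪q ⁅ x ⁆) (x∈p∪⁅x⁆ x M))
    in ⊥-elim (e∉ξA (M , fM , avoidsΓ⇒≈ fA fM M-avoids A≤M , e∈M))
    where
    P : Subset n → Set
    P Y = Feasible Y × e ∈ Y × Y ⊆ᴾ (λ y → ¬ Γ′ A y)
    P? : ∀ Y → Dec (P Y)
    P? Y = Feasible? Y ×-dec e ∈? Y ×-dec ⊆ᴾ? (λ y → ¬? (Γ? A y)) Y
    start : P (X ∪ ⁅ e ⁆)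
    start = fXe , x∈p∪⁅x⁆ e X , p∪⁅x⁆⊆ᴾ (λ y y∈X → ξ⇒¬Γ (X⊆ξA y y∈X)) e∉ΓA

  covector-Γ : ∀ α → IsCovectorOn G 𝓕 A α → Γ′ A e → IsSign (α ⟨ e ⟩)
  covector-Γ _ (_ , sign) = proj₁ (sign _)

  covector-ξ : ∀ α → IsCovectorOn G 𝓕 A α → ξ′ A e → α ⟨ e ⟩ ≡ 𝟎
  covector-ξ _ (_ , sign) = proj₁ (proj₂ (sign _))

  covector-else : ∀ α → IsCovectorOn G 𝓕 A α → ¬ Γ′ A e → ¬ ξ′ A e → α ⟨ e ⟩ ≡ 𝟏
  covector-else _ (_ , sign) = proj₂ (proj₂ (sign _))

  covector-𝟎⇒ξ : ∀ α → IsCovectorOn G 𝓕 A α → α ⟨ e ⟩ ≡ 𝟎 → ξ′ A e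
  covector-𝟎⇒ξ {A} {e} α cov αₑ≡𝟎 with ξ? A e | Γ? A e
  ... | yes e∈ξA | _        = e∈ξA
  ... | no  _    | yes e∈ΓA = ⊥-elim (sign≢𝟎 (covector-Γ α cov e∈ΓA) αₑ≡𝟎)
  ... | no  e∉ξA | no e∉ΓA  = ⊥-elim (𝟏≢𝟎 (trans (sym (covector-else α cov e∉ΓA e∉ξA)) αₑ≡𝟎))

  neg-covector : ∀ α → IsCovectorOn G 𝓕 A α → IsCovectorOn G 𝓕 A (map neg α)
  neg-covector α cov@(fA , _) = fA , λ e →
    neg-IsSign α ∘ covector-Γ α cov , neg-≡ α ∘ covector-ξ α cov ,
    λ e∉ΓA e∉ξA → neg-≡ α (covector-else α cov e∉ΓA e∉ξA)

  product : Subset n → SignVec n → SignVec n → SignVec n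
  product C α β = tabulate λ e → keepOr𝟏 (Γ? C e ⊎-dec ξ? C e) (α ⟨ e ⟩ ∘ˢ β ⟨ e ⟩)

  product-inside : ∀ α β → Γ′ C e ⊎ ξ′ C e → product C α β ⟨ e ⟩ ≡ α ⟨ e ⟩ ∘ˢ β ⟨ e ⟩
  product-inside {C} {e} _ _ inside = trans (lookup∘tabulate _ e) (keepOr𝟏-yes (Γ? C e ⊎-dec ξ? C e) inside)

  product-outside : ∀ α β → ¬ (Γ′ C e ⊎ ξ′ C e) → product C α β ⟨ e ⟩ ≡ 𝟏
  product-outside {C} {e} _ _ outside = trans (lookup∘tabulate _ e) (keepOr𝟏-no (Γ? C e ⊎-dec ξ? C e) outside)

  product-IsProduct : ∀ α β → IsCovectorOn G 𝓕 A α → IsCovectorOn G 𝓕 B β → IsJoin G 𝓕 A B C →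
                      IsProduct G 𝓕 α β (product C α β)
  product-IsProduct α β covα covβ join = _ , _ , _ , covα , covβ , join , λ e →
    (λ inside α<β → trans (product-inside α β inside) (∘ˢ-< α<β)) ,
    (λ inside α≮β → trans (product-inside α β inside) (∘ˢ-≮ α≮β)) ,
    product-outside α β

  product-𝟎⇒ξ : ∀ α β → IsCovectorOn G 𝓕 A α → IsCovectorOn G 𝓕 B β → product C α β ⟨ e ⟩ ≡ 𝟎 → ξ′ A e × ξ′ B e
  product-𝟎⇒ξ {C = C} {e} α β covα covβ αβₑ≡𝟎 with Γ? C e ⊎-dec ξ? C e
  ... | yes inside  = let αₑ≡𝟎 , βₑ≡𝟎 = ∘ˢ-≡𝟎⁻ (α ⟨ e ⟩) (β ⟨ e ⟩) (trans (sym (product-inside α β inside)) αβₑ≡𝟎)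
                      in covector-𝟎⇒ξ α covα αₑ≡𝟎 , covector-𝟎⇒ξ β covβ βₑ≡𝟎
  ... | no  outside = ⊥-elim (𝟏≢𝟎 (trans (sym (product-outside α β outside)) αβₑ≡𝟎))

  product-support : ∀ α β → IsCovectorOn G 𝓕 A α → IsCovectorOn G 𝓕 B β → IsJoin G 𝓕 A B C →
                    IsCovectorOn G 𝓕 C″ (product C α β) → C ≈ C″
  product-support {C = C} {C″} α β covα covβ join@(fC , C⊆ξA∩ξB , _) covαβ@(fC″ , _) =
    avoidsΓ⇒≈ fC″ fC C-avoids C″≤C
    where
    C″≤C : ∣ C″ ∣ ≤ ∣ C ∣
    C″≤C = IsMu-rank-maximum join fC″ λ e e∈C″ →
      product-𝟎⇒ξ α β covα covβ (covector-ξ (product C α β) covαβ (⊆ξ fC″ e e∈C″))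
    αβ-vanishes-on-C : ∀ c → c ∈ C → product C α β ⟨ c ⟩ ≡ 𝟎
    αβ-vanishes-on-C c c∈C = let c∈ξA , c∈ξB = C⊆ξA∩ξB c c∈C in begin
      product C α β ⟨ c ⟩  ≡⟨ product-inside α β (inj₂ (⊆ξ fC c c∈C)) ⟩
      α ⟨ c ⟩ ∘ˢ β ⟨ c ⟩   ≡⟨ cong₂ _∘ˢ_ (covector-ξ α covα c∈ξA) (covector-ξ β covβ c∈ξB) ⟩
      𝟎                    ∎
    C-avoids : C ⊆ᴾ (λ c → ¬ Γ′ C″ c)
    C-avoids c c∈C = ξ⇒¬Γ (covector-𝟎⇒ξ (product C α β) covαβ (αβ-vanishes-on-C c c∈C))

module RestrictF {n : ℕ} (𝓕 : Subset n → Bool) (W : Subset n) where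

  restrictF⁺ : ∀ {X} → T (𝓕 X) → X ⊆ W → T (restrictF 𝓕 W X)
  restrictF⁺ {X} fX X⊆W = Equivalence.from T-∧ (fX , fromWitness {a? = X ⊆? W} X⊆W)

  restrictF⁻-feasible : ∀ {X} → T (restrictF 𝓕 W X) → T (𝓕 X)
  restrictF⁻-feasible = proj₁ ∘ Equivalence.to T-∧

  restrictF⁻-⊆ : ∀ {X} → T (restrictF 𝓕 W X) → X ⊆ W
  restrictF⁻-⊆ {X} fX = toWitness {a? = X ⊆? W} (proj₂ (Equivalence.to T-∧ fX))

  restrictF-isIntervalGreedoid : ∀ {G} → IsIntervalGreedoid G 𝓕 → IsIntervalGreedoid W (restrictF 𝓕 W)
  restrictF-isIntervalGreedoid ig = record
    { ground   = λ _ → restrictF⁻-⊆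
    ; nonempty = ⊥ , restrictF⁺ ⊥-feasible ⊥⊆
    ; IG1 = λ X fX ne →
        let x , x∈X , fX-x = IG1 X (restrictF⁻-feasible fX) ne
        in x , x∈X , restrictF⁺ fX-x (restrictF⁻-⊆ fX ∘ p─q⊆p X ⁅ x ⁆)
    ; IG2 = λ X Y fX fY Y<X →
        let x , x∈X , x∉Y , fYx = IG2 X Y (restrictF⁻-feasible fX) (restrictF⁻-feasible fY) Y<X
        in x , x∈X , x∉Y , restrictF⁺ fYx (p∪⁅x⁆⊆W (restrictF⁻-⊆ fY) (restrictF⁻-⊆ fX x∈X))
    ; IG3 = λ X Y Z e fX fY fZ X⊆Y Y⊆Z e∉Z fXe fZe →
        let Ze⊆W = restrictF⁻-⊆ fZe
        in restrictF⁺ (IG3 X Y Z e (restrictF⁻-feasible fX) (restrictF⁻-feasible fY) (restrictF⁻-feasible fZ)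
                         X⊆Y Y⊆Z e∉Z (restrictF⁻-feasible fXe) (restrictF⁻-feasible fZe))
                      (p∪⁅x⁆⊆W (Ze⊆W ∘ p⊆p∪q ⁅ e ⁆ ∘ Y⊆Z) (Ze⊆W (x∈p∪⁅x⁆ e Z)))
    }
    where
    open Greedoid _ 𝓕 ig
    p∪⁅x⁆⊆W : ∀ {X x} → X ⊆ W → x ∈ W → X ∪ ⁅ x ⁆ ⊆ W
    p∪⁅x⁆⊆W X⊆W x∈W = p∪⁅x⁆⊆ᴾ {S = _∈ W} (λ _ → X⊆W) x∈W _

module Restriction {n : ℕ} (𝓕 : Subset n → Bool) (W : Subset n) (ig : IsIntervalGreedoid ⊤ 𝓕) where
  open RestrictF 𝓕 W public

  module E = Greedoid ⊤ 𝓕 ig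
  module R = Greedoid W (restrictF 𝓕 W) (restrictF-isIntervalGreedoid ig)

  private
    variable
      A D X : Subset n
      e : Fin n
      α γ : SignVec n

  IsRestrictedFlat : Subset n → Subset n → Set
  IsRestrictedFlat A D = IsMu W (restrictF 𝓕 W) (λ e → e ∈ W × E.ξ′ A e) D

  R-ξ⊆W : R.ξ′ X e → e ∈ W
  R-ξ⊆W (_ , fX′ , _ , e∈X′) = restrictF⁻-⊆ fX′ e∈X′

  restrictedFlat-exists : ∀ A → ∃ (IsRestrictedFlat A)
  restrictedFlat-exists A = R.IsMu-exists _ λ e → e ∈? W ×-dec E.ξ? A e

  restrictedFlat-self : R.Feasible A → IsRestrictedFlat A A
  restrictedFlat-self {A} fA = fA , A⊆W∩ξA , maximal
    where
    A⊆W∩ξA : A ⊆ᴾ (λ e → e ∈ W × E.ξ′ A e)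
    A⊆W∩ξA e e∈A = restrictF⁻-⊆ fA e∈A , E.⊆ξ (restrictF⁻-feasible fA) e e∈A
    maximal : ∀ Y → R.Feasible Y → A ⊆ Y → Y ⊆ᴾ (λ e → e ∈ W × E.ξ′ A e) → Y ⊆ A
    maximal Y fY A⊆Y Y⊆W∩ξA {y} y∈Y with y ∈? A
    ... | yes y∈A = y∈A
    ... | no  y∉A =
      let w , w∈Y , w∉A , fAw = E.IG2 Y A (restrictF⁻-feasible fY) (restrictF⁻-feasible fA)
                                  (p⊂q⇒∣p∣<∣q∣ (A⊆Y , y , y∈Y , y∉A))
      in ⊥-elim (E.ξ⇒¬Γ (proj₂ (Y⊆W∩ξA w w∈Y)) (E.Γ-intro fAw w∉A))

  restrictedFlat-Γ⊆Γ : E.Feasible A → IsRestrictedFlat A D → R.Γ′ D e → E.Γ′ A e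
  restrictedFlat-Γ⊆Γ {A} {e = e} fA flat@(_ , D⊆W∩ξA , _) e∈ΓD@(e∈W , _ , fDe) with E.ξ? A e
  ... | yes e∈ξA = ⊥-elim (R.IsMu-Γ-disjoint flat (e∈W , e∈ξA) e∈ΓD)
  ... | no  e∉ξA = E.ξ-extension⇒Γ fA (λ d → proj₂ ∘ D⊆W∩ξA d) e∉ξA (restrictF⁻-feasible fDe)

  module Agreement {A A′ : Subset n} (α γ : SignVec n)
           (cov : IsCovectorOn ⊤ 𝓕 A α) (cov′ : IsCovectorOn W (restrictF 𝓕 W) A′ γ)
           (agree : ∀ e → e ∈ W → γ ⟨ e ⟩ ≡ α ⟨ e ⟩) where

    ξ⁻ : R.ξ′ A′ e → E.ξ′ A e
    ξ⁻ e∈ξA′ = E.covector-𝟎⇒ξ α cov (trans (sym (agree _ (R-ξ⊆W e∈ξA′))) (R.covector-ξ γ cov′ e∈ξA′))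

    ξ⁺ : e ∈ W → E.ξ′ A e → R.ξ′ A′ e
    ξ⁺ e∈W e∈ξA = R.covector-𝟎⇒ξ γ cov′ (trans (agree _ e∈W) (E.covector-ξ α cov e∈ξA))

  res : Subset n → SignVec n → SignVec n
  res D α = tabulate λ e → covectorSign (R.ξ? D e) (R.Γ? D e) (α ⟨ e ⟩)

  res-on-ξ : ∀ α → R.ξ′ D e → res D α ⟨ e ⟩ ≡ 𝟎
  res-on-ξ {D} {e} _ e∈ξD = trans (lookup∘tabulate _ e) (covectorSign-P (R.ξ? D e) (R.Γ? D e) e∈ξD)

  res-IsRes : ∀ α → IsCovectorOn ⊤ 𝓕 A α → IsRestrictedFlat A D → IsRes ⊤ 𝓕 W α (res D α)
  res-IsRes {D = D} α cov flat = _ , cov , D , flat , λ e →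
    res-on-ξ α ,
    (λ e∈ΓD → trans (lookup∘tabulate _ e) (covectorSign-Q (R.ξ? D e) (R.Γ? D e) R.ξ⇒¬Γ e∈ΓD)) ,
    (λ e∉ξD e∉ΓD → trans (lookup∘tabulate _ e) (covectorSign-else (R.ξ? D e) (R.Γ? D e) e∉ξD e∉ΓD))

  IsRes-exists : ∀ α → IsCovector ⊤ 𝓕 α → ∃ (IsRes ⊤ 𝓕 W α)
  IsRes-exists α (A , cov) = let D , flat = restrictedFlat-exists A in res D α , res-IsRes α cov flat

  restrictedSupport : ∀ α γ → IsRes ⊤ 𝓕 W α γ → Subset n
  restrictedSupport _ _ (_ , _ , D , _) = D

  IsRes⇒IsCovectorOn : ∀ α γ (r : IsRes ⊤ 𝓕 W α γ) → IsCovectorOn W (restrictF 𝓕 W) (restrictedSupport α γ r) γ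
  IsRes⇒IsCovectorOn α γ (_ , cov@(fA , _) , _ , flat@(fD , _) , clauses) = fD , λ e →
    let on-ξ , on-Γ , elsewhere = clauses e in
    (λ e∈ΓD → subst IsSign (sym (on-Γ e∈ΓD)) (E.covector-Γ α cov (restrictedFlat-Γ⊆Γ fA flat e∈ΓD))) ,
    on-ξ , λ e∉ΓD e∉ξD → elsewhere e∉ξD e∉ΓD

  IsRes-≢𝟏⇒∈W : ∀ α γ → IsRes ⊤ 𝓕 W α γ → γ ⟨ e ⟩ ≢ 𝟏 → e ∈ W
  IsRes-≢𝟏⇒∈W {e} _ _ (_ , _ , _ , _ , clauses) γₑ≢𝟏 with e ∈? W
  ... | yes e∈W = e∈W
  ... | no  e∉W = ⊥-elim (γₑ≢𝟏 (proj₂ (proj₂ (clauses e)) (e∉W ∘ R-ξ⊆W) (e∉W ∘ proj₁)))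

  IsRes-neg : ∀ α γ → IsRes ⊤ 𝓕 W α γ → IsRes ⊤ 𝓕 W (map neg α) (map neg γ)
  IsRes-neg α γ (A , cov , D , flat , clauses) = A , E.neg-covector α cov , D , flat , λ e →
    let on-ξ , on-Γ , elsewhere = clauses e in
    neg-≡ γ ∘ on-ξ , neg-cong γ α ∘ on-Γ , λ e∉ξD e∉ΓD → neg-≡ γ (elsewhere e∉ξD e∉ΓD)

  -- γ = γ₁ ∘ γ₂ is res_W(α₁ ∘ α₂): the join C′ of the restricted supports turns out
  -- equivalent to the restriction D of the support C″ ∼ A₁ ∨ A₂ of α₁ ∘ α₂.
  module ProductOfRestrictions
    (α₁ α₂ γ₁ γ₂ γ : SignVec n) {A₁ A₂ C C″ D A′ B′ C′ : Subset n}
    (cov₁ : IsCovectorOn ⊤ 𝓕 A₁ α₁) (cov₂ : IsCovectorOn ⊤ 𝓕 A₂ α₂)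
    (cov′₁ : IsCovectorOn W (restrictF 𝓕 W) A′ γ₁) (cov′₂ : IsCovectorOn W (restrictF 𝓕 W) B′ γ₂)
    (agree₁ : ∀ e → e ∈ W → γ₁ ⟨ e ⟩ ≡ α₁ ⟨ e ⟩) (agree₂ : ∀ e → e ∈ W → γ₂ ⟨ e ⟩ ≡ α₂ ⟨ e ⟩)
    (join : IsJoin ⊤ 𝓕 A₁ A₂ C) (join′ : IsJoin W (restrictF 𝓕 W) A′ B′ C′)
    (γ-inside : ∀ {e} → R.Γ′ C′ e ⊎ R.ξ′ C′ e → γ ⟨ e ⟩ ≡ γ₁ ⟨ e ⟩ ∘ˢ γ₂ ⟨ e ⟩)
    (γ-outside : ∀ {e} → ¬ (R.Γ′ C′ e ⊎ R.ξ′ C′ e) → γ ⟨ e ⟩ ≡ 𝟏)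
    (covα : IsCovectorOn ⊤ 𝓕 C″ (E.product C α₁ α₂))
    (flat : IsRestrictedFlat C″ D)
    (restrictedFlat-ξ⊆ξ : ∀ {e} → R.ξ′ D e → E.ξ′ C″ e)
    where

    module Agree₁ = Agreement α₁ γ₁ cov₁ cov′₁ agree₁
    module Agree₂ = Agreement α₂ γ₂ cov₂ cov′₂ agree₂

    α₁₂ : SignVec n
    α₁₂ = E.product C α₁ α₂

    C≈C″ : C E.≈ C″
    C≈C″ = E.product-support α₁ α₂ cov₁ cov₂ join covα

    ξC″⊆ξA₁∩ξA₂ : E.ξ′ C″ e → E.ξ′ A₁ e × E.ξ′ A₂ e
    ξC″⊆ξA₁∩ξA₂ = E.product-𝟎⇒ξ α₁ α₂ cov₁ cov₂ ∘ E.covector-ξ α₁₂ covα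

    ΓD⊆ΓC : R.Γ′ D e → E.Γ′ C e
    ΓD⊆ΓC = proj₂ C≈C″ _ ∘ restrictedFlat-Γ⊆Γ (proj₁ covα) flat

    D≤C′ : ∣ D ∣ ≤ ∣ C′ ∣
    D≤C′ = R.IsMu-rank-maximum join′ (proj₁ flat) λ d d∈D →
      let d∈W , d∈ξC″ = proj₁ (proj₂ flat) d d∈D
          d∈ξA₁ , d∈ξA₂ = ξC″⊆ξA₁∩ξA₂ d∈ξC″
      in Agree₁.ξ⁺ d∈W d∈ξA₁ , Agree₂.ξ⁺ d∈W d∈ξA₂

    C′-avoids-ΓD : C′ ⊆ᴾ (λ c → ¬ R.Γ′ D c)
    C′-avoids-ΓD c c∈C′ c∈ΓD =
      let c∈ξA′ , c∈ξB′ = proj₁ (proj₂ join′) c c∈C′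
      in E.IsMu-Γ-disjoint join (Agree₁.ξ⁻ c∈ξA′ , Agree₂.ξ⁻ c∈ξB′) (ΓD⊆ΓC c∈ΓD)

    C′≈D : C′ R.≈ D
    C′≈D = R.avoidsΓ⇒≈ (proj₁ flat) (proj₁ join′) C′-avoids-ΓD D≤C′

    on-ξD : R.ξ′ D e → γ ⟨ e ⟩ ≡ 𝟎
    on-ξD {e} e∈ξD =
      let e∈W = R-ξ⊆W e∈ξD
          e∈ξA₁ , e∈ξA₂ = ξC″⊆ξA₁∩ξA₂ (restrictedFlat-ξ⊆ξ e∈ξD)
      in begin
        γ ⟨ e ⟩                ≡⟨ γ-inside (inj₂ (R.ξ-resp-≈ (R.≈-sym C′≈D) e∈ξD)) ⟩
        γ₁ ⟨ e ⟩ ∘ˢ γ₂ ⟨ e ⟩   ≡⟨ cong₂ _∘ˢ_ (agree₁ e e∈W) (agree₂ e e∈W) ⟩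
        α₁ ⟨ e ⟩ ∘ˢ α₂ ⟨ e ⟩   ≡⟨ cong₂ _∘ˢ_ (E.covector-ξ α₁ cov₁ e∈ξA₁) (E.covector-ξ α₂ cov₂ e∈ξA₂) ⟩
        𝟎                      ∎

    on-ΓD : R.Γ′ D e → γ ⟨ e ⟩ ≡ α₁₂ ⟨ e ⟩
    on-ΓD {e} e∈ΓD@(e∈W , _) = begin
      γ ⟨ e ⟩                ≡⟨ γ-inside (inj₁ (proj₂ C′≈D e e∈ΓD)) ⟩
      γ₁ ⟨ e ⟩ ∘ˢ γ₂ ⟨ e ⟩   ≡⟨ cong₂ _∘ˢ_ (agree₁ e e∈W) (agree₂ e e∈W) ⟩
      α₁ ⟨ e ⟩ ∘ˢ α₂ ⟨ e ⟩   ≡⟨ E.product-inside α₁ α₂ (inj₁ (ΓD⊆ΓC e∈ΓD)) ⟨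
      α₁₂ ⟨ e ⟩              ∎

    elsewhere : ¬ R.ξ′ D e → ¬ R.Γ′ D e → γ ⟨ e ⟩ ≡ 𝟏
    elsewhere e∉ξD e∉ΓD = γ-outside [ e∉ΓD ∘ proj₁ C′≈D _ , e∉ξD ∘ R.ξ-resp-≈ C′≈D ]

    γ-IsRes : IsRes ⊤ 𝓕 W α₁₂ γ
    γ-IsRes = C″ , covα , D , flat , λ _ → on-ξD , on-ΓD , elsewhere

module RestrictedOrientation {n : ℕ} (𝓕 : Subset n → Bool) (𝓛 : SignVec n → Set) (W : Subset n)
    (O : IsOrientedIntervalGreedoid ⊤ 𝓕 𝓛)
    (res-agrees : ∀ α → 𝓛 α → ∀ γ → IsRes ⊤ 𝓕 W α γ → ∀ e → e ∈ W → γ ⟨ e ⟩ ≡ α ⟨ e ⟩)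
  where
  open IsOrientedIntervalGreedoid O
  open Restriction 𝓕 W greedoid public

  𝓛∣W : SignVec n → Set
  𝓛∣W = restrictL ⊤ 𝓕 𝓛 W

  -- The hypothesis res_W(α) = α|_W pulls the zeros of res_W(α) back to α.
  restrictedFlat-ξ⊆ξ : ∀ {A D e} α → 𝓛 α → IsCovectorOn ⊤ 𝓕 A α → IsRestrictedFlat A D → R.ξ′ D e → E.ξ′ A e
  restrictedFlat-ξ⊆ξ {D = D} {e} α ℓ cov flat e∈ξD = E.covector-𝟎⇒ξ α cov (begin
    α ⟨ e ⟩        ≡⟨ res-agrees α ℓ (res D α) (res-IsRes α cov flat) e (R-ξ⊆W e∈ξD) ⟨
    res D α ⟨ e ⟩  ≡⟨ res-on-ξ α e∈ξD ⟩
    𝟎              ∎)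

  lift-product : ∀ α₁ α₂ γ₁ γ₂ γ → 𝓛 α₁ → 𝓛 α₂ → IsRes ⊤ 𝓕 W α₁ γ₁ → IsRes ⊤ 𝓕 W α₂ γ₂ →
                 IsProduct W (restrictF 𝓕 W) γ₁ γ₂ γ →
                 ∃ λ α → 𝓛 α × IsProduct ⊤ 𝓕 α₁ α₂ α × IsRes ⊤ 𝓕 W α γ
  lift-product α₁ α₂ γ₁ γ₂ γ ℓ₁ ℓ₂ r₁@(A₁ , cov₁ , _) r₂@(A₂ , cov₂ , _)
               (_ , _ , C′ , cov′₁ , cov′₂ , join′ , γ-clauses) =
    let C , join = E.join-exists A₁ A₂
        α₁₂ = E.product C α₁ α₂
        α₁₂-product = E.product-IsProduct α₁ α₂ cov₁ cov₂ join
        ℓ₁₂ = OG3 α₁ α₂ α₁₂ ℓ₁ ℓ₂ α₁₂-product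
        C″ , covα = covectors α₁₂ ℓ₁₂
        D , flat = restrictedFlat-exists C″
    in α₁₂ , ℓ₁₂ , α₁₂-product ,
       ProductOfRestrictions.γ-IsRes α₁ α₂ γ₁ γ₂ γ cov₁ cov₂ cov′₁ cov′₂
         (res-agrees α₁ ℓ₁ γ₁ r₁) (res-agrees α₂ ℓ₂ γ₂ r₂) join join′ γ-inside γ-outside
         covα flat (restrictedFlat-ξ⊆ξ α₁₂ ℓ₁₂ covα flat)
    where
    γ-inside : ∀ {e} → R.Γ′ C′ e ⊎ R.ξ′ C′ e → γ ⟨ e ⟩ ≡ γ₁ ⟨ e ⟩ ∘ˢ γ₂ ⟨ e ⟩
    γ-inside {e} inside = let if< , if≮ , _ = γ-clauses e in ∘ˢ-cases (if< inside) (if≮ inside)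
    γ-outside : ∀ {e} → ¬ (R.Γ′ C′ e ⊎ R.ξ′ C′ e) → γ ⟨ e ⟩ ≡ 𝟏
    γ-outside {e} = proj₂ (proj₂ (γ-clauses e))

  restricted-OG1 : ∀ A → Feas W (restrictF 𝓕 W) A → ∃ λ γ → 𝓛∣W γ × IsCovectorOn W (restrictF 𝓕 W) A γ
  restricted-OG1 A fA =
    let α , ℓ , cov = OG1 A (restrictF⁻-feasible fA)
        r = res-IsRes α cov (restrictedFlat-self fA)
    in res A α , (α , ℓ , r) , IsRes⇒IsCovectorOn α (res A α) r

  restricted-OG2 : ∀ γ → 𝓛∣W γ → 𝓛∣W (map neg γ)
  restricted-OG2 γ (α , ℓ , r) = map neg α , OG2 α ℓ , IsRes-neg α γ r

  restricted-OG3 : ∀ γ₁ γ₂ γ → 𝓛∣W γ₁ → 𝓛∣W γ₂ → IsProduct W (restrictF 𝓕 W) γ₁ γ₂ γ → 𝓛∣W γ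
  restricted-OG3 γ₁ γ₂ γ (α₁ , ℓ₁ , r₁) (α₂ , ℓ₂ , r₂) γ-product =
    let α , ℓ , _ , r = lift-product α₁ α₂ γ₁ γ₂ γ ℓ₁ ℓ₂ r₁ r₂ γ-product in α , ℓ , r

  restricted-OG4 : ∀ γ₁ γ₂ γ₁₂ γ₂₁ → 𝓛∣W γ₁ → 𝓛∣W γ₂ →
    IsProduct W (restrictF 𝓕 W) γ₁ γ₂ γ₁₂ → IsProduct W (restrictF 𝓕 W) γ₂ γ₁ γ₂₁ →
    ∀ x → Sep γ₁ γ₂ x → γ₁₂ ⟨ x ⟩ ≢ 𝟏 →
    ∃ λ δ → 𝓛∣W δ × δ ⟨ x ⟩ ≡ 𝟎 ×
      (∀ y → ¬ Sep γ₁ γ₂ y → γ₁₂ ⟨ y ⟩ ≢ 𝟏 → δ ⟨ y ⟩ ≡ γ₁₂ ⟨ y ⟩ × δ ⟨ y ⟩ ≡ γ₂₁ ⟨ y ⟩)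
  restricted-OG4 γ₁ γ₂ γ₁₂ γ₂₁ (α₁ , ℓ₁ , r₁) (α₂ , ℓ₂ , r₂) p₁₂ p₂₁ x x-sep γ₁₂ₓ≢𝟏 =
    let α₁₂ , ℓ₁₂ , q₁₂ , r₁₂ = lift-product α₁ α₂ γ₁ γ₂ γ₁₂ ℓ₁ ℓ₂ r₁ r₂ p₁₂
        α₂₁ , ℓ₂₁ , q₂₁ , r₂₁ = lift-product α₂ α₁ γ₂ γ₁ γ₂₁ ℓ₂ ℓ₁ r₂ r₁ p₂₁
        agree₁ = res-agrees α₁ ℓ₁ γ₁ r₁
        agree₂ = res-agrees α₂ ℓ₂ γ₂ r₂
        agree₁₂ = res-agrees α₁₂ ℓ₁₂ γ₁₂ r₁₂
        agree₂₁ = res-agrees α₂₁ ℓ₂₁ γ₂₁ r₂₁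
        x∈W = IsRes-≢𝟏⇒∈W α₁ γ₁ r₁ (Sep⇒≢𝟏 γ₁ γ₂ x x-sep)
        δ , ℓδ , δₓ≡𝟎 , δ-eliminates = OG4 α₁ α₂ α₁₂ α₂₁ ℓ₁ ℓ₂ q₁₂ q₂₁ x
          (Sep-cong γ₁ γ₂ α₁ α₂ (agree₁ x x∈W) (agree₂ x x∈W) x-sep) (γ₁₂ₓ≢𝟏 ∘ trans (agree₁₂ x x∈W))
        γδ , rδ = IsRes-exists δ (covectors δ ℓδ)
        agreeδ = res-agrees δ ℓδ γδ rδ
    in γδ , (δ , ℓδ , rδ) , trans (agreeδ x x∈W) δₓ≡𝟎 , λ y y-not-sep γ₁₂ᵧ≢𝟏 →
      let y∈W = IsRes-≢𝟏⇒∈W α₁₂ γ₁₂ r₁₂ γ₁₂ᵧ≢𝟏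
          δᵧ≡α₁₂ᵧ , δᵧ≡α₂₁ᵧ = δ-eliminates y
            (y-not-sep ∘ Sep-cong α₁ α₂ γ₁ γ₂ (sym (agree₁ y y∈W)) (sym (agree₂ y y∈W)))
            (γ₁₂ᵧ≢𝟏 ∘ trans (agree₁₂ y y∈W))
      in trans (agreeδ y y∈W) (trans δᵧ≡α₁₂ᵧ (sym (agree₁₂ y y∈W))) ,
         trans (agreeδ y y∈W) (trans δᵧ≡α₂₁ᵧ (sym (agree₂₁ y y∈W)))

mainTheorem11 : {n : ℕ} (𝓕 : Subset n → Bool) (𝓛 : SignVec n → Set) (W : Subset n) →
    IsOrientedIntervalGreedoid ⊤ 𝓕 𝓛 →
    (∀ α → 𝓛 α → ∀ γ → IsRes ⊤ 𝓕 W α γ → ∀ e → e ∈ W → γ ⟨ e ⟩ ≡ α ⟨ e ⟩) →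
    IsOrientedIntervalGreedoid W (restrictF 𝓕 W) (restrictL ⊤ 𝓕 𝓛 W)
mainTheorem11 𝓕 𝓛 W O res-agrees = record
  { greedoid  = restrictF-isIntervalGreedoid greedoid
  ; covectors = λ { γ (α , _ , r) → restrictedSupport α γ r , IsRes⇒IsCovectorOn α γ r }
  ; OG1 = restricted-OG1
  ; OG2 = restricted-OG2
  ; OG3 = restricted-OG3
  ; OG4 = restricted-OG4
  }
  where
  open IsOrientedIntervalGreedoid O using (greedoid)
  open RestrictedOrientation 𝓕 𝓛 W O res-agrees
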